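{- Let $N = q^k n^2$ be an odd perfect number given in Eulerian form. Define $G = \gcd(\sigma(q^k),\sigma(n^2))$ and $I = \gcd(n,\sigma(n^2))$. Then the following conditions are equivalent: (1) $\sigma(q^k)/2$ divides $n$; (2) $n$ divides $\sigma(n^2)$; (3) $G = \sigma(q^k)/2$; (4) $I = n$.
   Context: $\sigma(x)$ denotes the sum of the positive divisors of $x$. A positive integer $N$ is perfect if $\sigma(N)=2N$. An odd perfect number $N$ is said to be given in Eulerian form $N = q^k n^2$ if $q$ is a prime (the special prime), $k$ and $n$ are positive integers, $q \equiv k \equiv 1 \pmod 4$, and $\gcd(q,n)=1$. -}

module Defs where

open import Data.Nat using (ℕ; suc; _+_; _*_; _^_; _/_; _%_)
open import Data.Nat.Divisibility using (_∣?_)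
open import Data.List using (List; filter; upTo; map)
open import Data.Nat.ListAction using (sum)
open import Data.Nat.GCD using (gcd)
open import Data.Nat.Primality using (Prime)
open import Data.Product using (_×_)
open import Relation.Binary.PropositionalEquality using (_≡_)

-- divisors of x: all d with 1 ≤ d ≤ x and d ∣ x (empty list for x = 0)
divisors : ℕ → List ℕ
divisors x = filter (_∣? x) (map suc (upTo x))

σ : ℕ → ℕ
σ x = sum (divisors x)

Perfect : ℕ → Set
Perfect N = (0 Data.Nat.< N) × (σ N ≡ 2 * N)

EulerianOPN : ℕ → ℕ → ℕ → ℕ → Set
EulerianOPN N q k n =
  Perfect N × (N % 2 ≡ 1) × (N ≡ q ^ k * (n * n)) × Prime q ×
  (0 Data.Nat.< k) × (0 Data.Nat.< n) × (q % 4 ≡ 1) × (k % 4 ≡ 1) × (gcd q n ≡ 1)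

-- For a prime q not dividing m, σ(q^k m) = (1 + q + ⋯ + q^k) σ(m), so σ(N) = σ(q^k) σ(n²) = 2 q^k n².
-- As q and k are odd, 1 + q divides σ(q^k), so σ(q^k) = 2h; and σ(q^k) ≡ 1 (mod q), so q ∤ h.
-- Hence h σ(n²) = q^k n² with gcd(h, q) = 1, giving σ(n²) = q^k m with h m = n², and σ(n²) is odd
-- because N is. Every condition now reduces to n ∣ σ(n²): h ∣ n ⇔ n ∣ m as h m = n², and n ∣ m ⇔
-- n ∣ σ(n²) as gcd(n, q) = 1; since σ(n²) is odd, G = gcd(2h, σ(n²)) = h ⇔ h ∣ σ(n²) ⇔ h ∣ m,
-- and h ∣ m ⇔ h ∣ n because h² ∣ h m = n² forces h ∣ n; finally I = n ⇔ n ∣ σ(n²).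
module Submission where

open import Defs
open import Data.Bool using (true; false; if_then_else_)
open import Data.Empty using (⊥-elim)
open import Data.List using ([_]; _++_; filter; upTo; map)
open import Data.List.Properties using (upTo-∷ʳ; map-++; filter-++)
open import Data.Nat
open import Data.Nat.Coprimality using (Coprime; coprime-divisor; gcd≡1⇒coprime; coprime-/gcd)
import Data.Nat.Coprimality as Coprime
open import Data.Nat.Divisibility
open import Data.Nat.DivMod
open import Data.Nat.GCD
open import Data.Nat.ListAction using (sum)
open import Data.Nat.ListAction.Properties using (sum-++)
open import Data.Nat.Primality
open import Data.Nat.Properties
open import Data.Nat.Tactic.RingSolver using (solve-∀)
open import Data.Product using (∃; _×_; _,_)
open import Data.Sum using (inj₁; inj₂; reduce)
open import Function using (id)
open import Function.Bundles using (_⇔_; mk⇔; Equivalence)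
open import Function.Properties.Equivalence using (⇔-setoid)
open import Level using (0ℓ)
import Relation.Binary.Reasoning.Setoid (⇔-setoid 0ℓ) as ⇔-Reasoning
open import Relation.Nullary using (¬_; Dec; yes; no; does)
open import Relation.Nullary.Decidable using (dec-true; dec-false)
open import Relation.Unary using (Decidable)
open import Relation.Binary.PropositionalEquality hiding ([_])
open import Algebra.Properties.CommutativeSemigroup +-commutativeSemigroup using (interchange)

∑ : (ℕ → ℕ) → ℕ → ℕ
∑ f zero    = 0
∑ f (suc X) = ∑ f X + f (suc X)

∑-cong : ∀ {f g} X → (∀ i → f i ≡ g i) → ∑ f X ≡ ∑ g X
∑-cong zero    f≗g = refl
∑-cong (suc X) f≗g = cong₂ _+_ (∑-cong X f≗g) (f≗g (suc X))

∑-vanishes : ∀ {f} X → (∀ {i} → 0 < i → i ≤ X → f i ≡ 0) → ∑ f X ≡ 0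
∑-vanishes zero    f≗0 = refl
∑-vanishes (suc X) f≗0 =
  cong₂ _+_ (∑-vanishes X (λ 0<i i≤X → f≗0 0<i (m≤n⇒m≤1+n i≤X))) (f≗0 z<s ≤-refl)

∑-distrib-+ : ∀ f g X → ∑ (λ i → f i + g i) X ≡ ∑ f X + ∑ g X
∑-distrib-+ f g zero    = refl
∑-distrib-+ f g (suc X) = begin
  ∑ (λ i → f i + g i) X + (f (suc X) + g (suc X))
    ≡⟨ cong (_+ (f (suc X) + g (suc X))) (∑-distrib-+ f g X) ⟩
  ∑ f X + ∑ g X + (f (suc X) + g (suc X))
    ≡⟨ interchange (∑ f X) (∑ g X) (f (suc X)) (g (suc X)) ⟩
  ∑ f X + f (suc X) + (∑ g X + g (suc X)) ∎
  where open ≡-Reasoning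

∑-distribˡ-* : ∀ c f X → ∑ (λ i → c * f i) X ≡ c * ∑ f X
∑-distribˡ-* c f zero    = sym (*-zeroʳ c)
∑-distribˡ-* c f (suc X) =
  trans (cong (_+ c * f (suc X)) (∑-distribˡ-* c f X)) (sym (*-distribˡ-+ c (∑ f X) (f (suc X))))

∑-++ : ∀ f a b → ∑ f (a + b) ≡ ∑ f a + ∑ (λ i → f (a + i)) b
∑-++ f a zero    = trans (cong (∑ f) (+-identityʳ a)) (sym (+-identityʳ (∑ f a)))
∑-++ f a (suc b) = begin
  ∑ f (a + suc b)                                      ≡⟨ cong (∑ f) (+-suc a b) ⟩
  ∑ f (a + b) + f (suc (a + b))                        ≡⟨ cong (_+ f (suc (a + b))) (∑-++ f a b) ⟩
  ∑ f a + ∑ (λ i → f (a + i)) b + f (suc (a + b))      ≡⟨ cong (λ j → ∑ f a + ∑ (λ i → f (a + i)) b + f j) (+-suc a b) ⟨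
  ∑ f a + ∑ (λ i → f (a + i)) b + f (a + suc b)        ≡⟨ +-assoc (∑ f a) _ _ ⟩
  ∑ f a + ∑ (λ i → f (a + i)) (suc b)                  ∎
  where open ≡-Reasoning

restrict : {P : ℕ → Set} → Decidable P → (ℕ → ℕ) → ℕ → ℕ
restrict P? f d = if does (P? d) then f d else 0

restrict-∈ : ∀ {P : ℕ → Set} (P? : Decidable P) f {d} → P d → restrict P? f d ≡ f d
restrict-∈ P? f {d} p rewrite dec-true (P? d) p = refl

restrict-∉ : ∀ {P : ℕ → Set} (P? : Decidable P) f {d} → ¬ P d → restrict P? f d ≡ 0
restrict-∉ P? f {d} ¬p rewrite dec-false (P? d) ¬p = refl

sum-filter-[1‥] : ∀ {P : ℕ → Set} (P? : Decidable P) x →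
  sum (filter P? (map suc (upTo x))) ≡ ∑ (restrict P? id) x
sum-filter-[1‥] P? zero    = refl
sum-filter-[1‥] P? (suc x) = begin
  sum (filter P? (map suc (upTo (suc x))))
    ≡⟨ cong (λ l → sum (filter P? (map suc l))) (upTo-∷ʳ x) ⟨
  sum (filter P? (map suc (upTo x ++ [ x ])))
    ≡⟨ cong (λ l → sum (filter P? l)) (map-++ suc (upTo x) [ x ]) ⟩
  sum (filter P? (map suc (upTo x) ++ [ suc x ]))
    ≡⟨ cong sum (filter-++ P? (map suc (upTo x)) [ suc x ]) ⟩
  sum (filter P? (map suc (upTo x)) ++ filter P? [ suc x ])
    ≡⟨ sum-++ (filter P? (map suc (upTo x))) (filter P? [ suc x ]) ⟩
  sum (filter P? (map suc (upTo x))) + sum (filter P? [ suc x ])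
    ≡⟨ cong₂ _+_ (sum-filter-[1‥] P? x) sum-filter-[x] ⟩
  ∑ (restrict P? id) (suc x) ∎
  where
  open ≡-Reasoning
  sum-filter-[x] : sum (filter P? [ suc x ]) ≡ restrict P? id (suc x)
  sum-filter-[x] with does (P? (suc x))
  ... | true  = +-identityʳ (suc x)
  ... | false = refl

divisorTerm : ℕ → ℕ → ℕ
divisorTerm x = restrict (_∣? x) id

σ≡∑divisorTerm : ∀ {x} X .{{_ : NonZero x}} → x ≤ X → σ x ≡ ∑ (divisorTerm x) X
σ≡∑divisorTerm {x} X x≤X = begin
  σ x                                          ≡⟨ sum-filter-[1‥] (_∣? x) x ⟩
  ∑ t x                                        ≡⟨ +-identityʳ (∑ t x) ⟨
  ∑ t x + 0                                    ≡⟨ cong (∑ t x +_) (∑-vanishes (X ∸ x) beyond) ⟨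
  ∑ t x + ∑ (λ i → t (x + i)) (X ∸ x)          ≡⟨ ∑-++ t x (X ∸ x) ⟨
  ∑ t (x + (X ∸ x))                            ≡⟨ cong (∑ t) (m+[n∸m]≡n x≤X) ⟩
  ∑ t X                                        ∎
  where
  open ≡-Reasoning
  t = divisorTerm x
  beyond : ∀ {i} → 0 < i → i ≤ X ∸ x → t (x + i) ≡ 0
  beyond 0<i _ = restrict-∉ (_∣? x) id (λ x+i∣x → <⇒≱ (m<m+n x 0<i) (∣⇒≤ x+i∣x))

∑-dilate : ∀ c .{{_ : NonZero c}} g X → ∑ (restrict (c ∣?_) (λ d → g (d / c))) (X * c) ≡ ∑ g X
∑-dilate (suc c) g zero    = refl
∑-dilate (suc c) g (suc X) = begin
  ∑ f (suc c + X * suc c)                           ≡⟨ cong (∑ f) (+-comm (suc c) (X * suc c)) ⟩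
  ∑ f (X * suc c + suc c)                           ≡⟨ ∑-++ f (X * suc c) (suc c) ⟩
  ∑ f (X * suc c) + (∑ (λ i → f (X * suc c + i)) c + f (X * suc c + suc c))
    ≡⟨ cong₂ (λ a b → a + (b + f (X * suc c + suc c))) (∑-dilate (suc c) g X) (∑-vanishes c off-multiples) ⟩
  ∑ g X + f (X * suc c + suc c)                     ≡⟨ cong (λ j → ∑ g X + f j) (+-comm (X * suc c) (suc c)) ⟩
  ∑ g X + f (suc X * suc c)                         ≡⟨ cong (∑ g X +_) at-multiple ⟩
  ∑ g (suc X)                                       ∎
  where
  open ≡-Reasoning
  g∘/c : ℕ → ℕ
  g∘/c d = g (d / suc c)
  f = restrict (suc c ∣?_) g∘/c
  off-multiples : ∀ {i} → 0 < i → i ≤ c → f (X * suc c + i) ≡ 0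
  off-multiples {i} 0<i i≤c = restrict-∉ (suc c ∣?_) g∘/c λ c∣ →
    <⇒≱ (s≤s i≤c) (∣⇒≤ {{>-nonZero 0<i}} (∣m+n∣m⇒∣n c∣ (n∣m*n X)))
  at-multiple : f (suc X * suc c) ≡ g (suc X)
  at-multiple = trans (restrict-∈ (suc c ∣?_) g∘/c (n∣m*n (suc X))) (cong g (m*n/n≡m (suc X) (suc c)))

¬∣⇒coprime : ∀ {p d} → Prime p → ¬ p ∣ d → Coprime p d
¬∣⇒coprime {p} {d} p-prime p∤d (i∣p , i∣d) with prime⇒irreducible p-prime i∣p
... | inj₁ i≡1 = i≡1
... | inj₂ i≡p = ⊥-elim (p∤d (subst (_∣ d) i≡p i∣d))

coprime-^ : ∀ {m n} k → Coprime n m → Coprime n (m ^ k)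
coprime-^ zero    n⊥m (_ , i∣1)           = ∣1⇒≡1 i∣1
coprime-^ (suc k) n⊥m {i} (i∣n , i∣m^1+k) = coprime-^ k n⊥m (i∣n , coprime-divisor i⊥m i∣m^1+k)
  where
  i⊥m : Coprime i _
  i⊥m (j∣i , j∣m) = n⊥m (∣-trans j∣i i∣n , j∣m)

∣p^[1+k]*m∧∤p^k*m⇒p^[1+k]∣ : ∀ {p} → Prime p → ∀ k {d m} →
  d ∣ p ^ suc k * m → ¬ d ∣ p ^ k * m → p ^ suc k ∣ d
∣p^[1+k]*m∧∤p^k*m⇒p^[1+k]∣ {p} p-prime k {d} {m} d∣ d∤ with p ∣? d
... | no p∤d =
  ⊥-elim (d∤ (coprime-divisor (Coprime.sym (¬∣⇒coprime p-prime p∤d)) (subst (d ∣_) (*-assoc p (p ^ k) m) d∣)))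
∣p^[1+k]*m∧∤p^k*m⇒p^[1+k]∣ {p} p-prime zero    {_} {m} d∣ d∤ | yes (divides d′ refl) =
  subst (_∣ d′ * p) (sym (*-identityʳ p)) (n∣m*n d′)
∣p^[1+k]*m∧∤p^k*m⇒p^[1+k]∣ {p} p-prime (suc k) {_} {m} d∣ d∤ | yes (divides d′ refl) =
  subst (p * p ^ suc k ∣_) (*-comm p d′) (*-monoʳ-∣ p p^[1+k]∣d′)
  where
  instance
    p≢0 : NonZero p
    p≢0 = prime⇒nonZero p-prime
  p^[1+k]∣d′ : p ^ suc k ∣ d′
  p^[1+k]∣d′ = ∣p^[1+k]*m∧∤p^k*m⇒p^[1+k]∣ p-prime k
    (*-cancelˡ-∣ p (subst₂ _∣_ (*-comm d′ p) (*-assoc p (p ^ suc k) m) d∣))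
    (λ d′∣ → d∤ (subst₂ _∣_ (*-comm p d′) (sym (*-assoc p (p ^ k) m)) (*-monoʳ-∣ p d′∣)))

geomSum : ℕ → ℕ → ℕ
geomSum p zero    = 1
geomSum p (suc k) = geomSum p k + p ^ suc k

module _ {p m : ℕ} (p-prime : Prime p) (p∤m : ¬ p ∣ m) .{{_ : NonZero m}} where

  -- A divisor of p^(1+k) m either divides p^k m or is p^(1+k) e with e ∣ m; newTerm collects the latter.
  private module NewDivisors (k : ℕ) where
    c = p ^ suc k
    y = p ^ k * m
    x = c * m

    instance
      p^k≢0 : NonZero (p ^ k)
      p^k≢0 = m^n≢0 p k {{prime⇒nonZero p-prime}}
      c≢0 : NonZero c
      c≢0 = m^n≢0 p (suc k) {{prime⇒nonZero p-prime}}
      y≢0 : NonZero y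
      y≢0 = m*n≢0 (p ^ k) m
      x≢0 : NonZero x
      x≢0 = m*n≢0 c m

    scaledDivisorTerm : ℕ → ℕ
    scaledDivisorTerm d = c * divisorTerm m (d / c)

    newTerm : ℕ → ℕ
    newTerm = restrict (c ∣?_) scaledDivisorTerm

    y∣x : y ∣ x
    y∣x = subst (y ∣_) (sym (*-assoc p (p ^ k) m)) (n∣m*n p)

    c∤divisor-of-y : ∀ {d} → d ∣ y → ¬ c ∣ d
    c∤divisor-of-y d∣y c∣d =
      p∤m (*-cancelˡ-∣ (p ^ k) (subst (_∣ y) (*-comm p (p ^ k)) (∣-trans c∣d d∣y)))

    divisorTerm-split : ∀ d → divisorTerm x d ≡ divisorTerm y d + newTerm d
    divisorTerm-split d = by-cases (d ∣? y) (d ∣? x)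
      where
      open ≡-Reasoning
      by-cases : Dec (d ∣ y) → Dec (d ∣ x) → divisorTerm x d ≡ divisorTerm y d + newTerm d
      by-cases (yes d∣y) _ = begin
        divisorTerm x d                ≡⟨ restrict-∈ (_∣? x) id (∣-trans d∣y y∣x) ⟩
        d                              ≡⟨ +-identityʳ d ⟨
        d + 0                          ≡⟨ cong₂ _+_ (restrict-∈ (_∣? y) id d∣y)
                                                    (restrict-∉ (c ∣?_) scaledDivisorTerm (c∤divisor-of-y d∣y)) ⟨
        divisorTerm y d + newTerm d    ∎
      by-cases (no d∤y) (yes d∣x) = begin
        divisorTerm x d                ≡⟨ restrict-∈ (_∣? x) id d∣x ⟩
        d                              ≡⟨ m*[n/m]≡n c∣d ⟨
        c * (d / c)                    ≡⟨ cong (c *_) (restrict-∈ (_∣? m) id d/c∣m) ⟨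
        c * divisorTerm m (d / c)      ≡⟨ restrict-∈ (c ∣?_) scaledDivisorTerm c∣d ⟨
        newTerm d                      ≡⟨ cong (_+ newTerm d) (restrict-∉ (_∣? y) id d∤y) ⟨
        divisorTerm y d + newTerm d    ∎
        where
        c∣d : c ∣ d
        c∣d = ∣p^[1+k]*m∧∤p^k*m⇒p^[1+k]∣ p-prime k d∣x d∤y
        d/c∣m : d / c ∣ m
        d/c∣m = *-cancelˡ-∣ c (subst (_∣ x) (sym (m*[n/m]≡n c∣d)) d∣x)
      by-cases (no d∤y) (no d∤x) = begin
        divisorTerm x d                ≡⟨ restrict-∉ (_∣? x) id d∤x ⟩
        0                              ≡⟨ cong₂ _+_ (restrict-∉ (_∣? y) id d∤y) (newTerm≡0 (c ∣? d)) ⟨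
        divisorTerm y d + newTerm d    ∎
        where
        newTerm≡0 : Dec (c ∣ d) → newTerm d ≡ 0
        newTerm≡0 (no  c∤d) = restrict-∉ (c ∣?_) scaledDivisorTerm c∤d
        newTerm≡0 (yes c∣d) = begin
          newTerm d                    ≡⟨ restrict-∈ (c ∣?_) scaledDivisorTerm c∣d ⟩
          c * divisorTerm m (d / c)    ≡⟨ cong (c *_) (restrict-∉ (_∣? m) id d/c∤m) ⟩
          c * 0                        ≡⟨ *-zeroʳ c ⟩
          0                            ∎
          where
          d/c∤m : ¬ d / c ∣ m
          d/c∤m d/c∣m = d∤x (subst (_∣ x) (m*[n/m]≡n c∣d) (*-monoʳ-∣ c d/c∣m))

  σ[p^[1+k]*m] : ∀ k → σ (p ^ suc k * m) ≡ σ (p ^ k * m) + p ^ suc k * σ m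
  σ[p^[1+k]*m] k = begin
    σ x                                       ≡⟨ σ≡∑divisorTerm x ≤-refl ⟩
    ∑ (divisorTerm x) x                       ≡⟨ ∑-cong x divisorTerm-split ⟩
    ∑ (λ d → divisorTerm y d + newTerm d) x   ≡⟨ ∑-distrib-+ (divisorTerm y) newTerm x ⟩
    ∑ (divisorTerm y) x + ∑ newTerm x         ≡⟨ cong₂ _+_ (σ≡∑divisorTerm x (∣⇒≤ y∣x)) (cong (∑ newTerm) (*-comm m c)) ⟨
    σ y + ∑ newTerm (m * c)                   ≡⟨ cong (σ y +_) (∑-dilate c (λ e → c * divisorTerm m e) m) ⟩
    σ y + ∑ (λ e → c * divisorTerm m e) m     ≡⟨ cong (σ y +_) (∑-distribˡ-* c (divisorTerm m) m) ⟩
    σ y + c * ∑ (divisorTerm m) m             ≡⟨ cong (λ s → σ y + c * s) (σ≡∑divisorTerm m ≤-refl) ⟨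
    σ y + c * σ m                             ∎
    where
    open ≡-Reasoning
    open NewDivisors k

  σ[p^k*m] : ∀ k → σ (p ^ k * m) ≡ geomSum p k * σ m
  σ[p^k*m] zero    = trans (cong σ (*-identityˡ m)) (sym (*-identityˡ (σ m)))
  σ[p^k*m] (suc k) = begin
    σ (p ^ suc k * m)                       ≡⟨ σ[p^[1+k]*m] k ⟩
    σ (p ^ k * m) + p ^ suc k * σ m         ≡⟨ cong (_+ p ^ suc k * σ m) (σ[p^k*m] k) ⟩
    geomSum p k * σ m + p ^ suc k * σ m     ≡⟨ *-distribʳ-+ (σ m) (geomSum p k) (p ^ suc k) ⟨
    geomSum p (suc k) * σ m                 ∎
    where open ≡-Reasoning

σ[p^k] : ∀ {p} → Prime p → ∀ k → σ (p ^ k) ≡ geomSum p k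
σ[p^k] {p} p-prime k = begin
  σ (p ^ k)              ≡⟨ cong σ (*-identityʳ (p ^ k)) ⟨
  σ (p ^ k * 1)          ≡⟨ σ[p^k*m] p-prime p∤1 k ⟩
  geomSum p k * 1        ≡⟨ *-identityʳ (geomSum p k) ⟩
  geomSum p k            ∎
  where
  open ≡-Reasoning
  p∤1 : ¬ p ∣ 1
  p∤1 p∣1 = nonTrivial⇒≢1 {{prime⇒nonTrivial p-prime}} (∣1⇒≡1 p∣1)

p∤geomSum : ∀ {p} → p ≢ 1 → ∀ k → ¬ p ∣ geomSum p k
p∤geomSum     p≢1 zero    p∣1 = p≢1 (∣1⇒≡1 p∣1)
p∤geomSum {p} p≢1 (suc k) p∣  =
  p∤geomSum p≢1 k (∣m+n∣m⇒∣n (subst (p ∣_) (+-comm (geomSum p k) (p ^ suc k)) p∣) (m∣m*n (p ^ k)))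

1+p∣geomSum[1+2t] : ∀ p t → 1 + p ∣ geomSum p (1 + 2 * t)
1+p∣geomSum[1+2t] p zero    = subst (λ z → 1 + p ∣ 1 + z) (sym (*-identityʳ p)) ∣-refl
1+p∣geomSum[1+2t] p (suc t) =
  subst (λ j → 1 + p ∣ geomSum p (1 + j)) (sym (*-suc 2 t))
    (subst (1 + p ∣_) (sym (+-assoc (geomSum p (1 + 2 * t)) a (p * a)))
      (∣m∣n⇒∣m+n (1+p∣geomSum[1+2t] p t) (m∣m*n a)))
  where
  a = p ^ (2 + 2 * t)

%4≡1⇒odd : ∀ x → x % 4 ≡ 1 → ∃ λ t → x ≡ 1 + 2 * t
%4≡1⇒odd x x%4≡1 = 2 * (x / 4) , trans (m≡m%n+[m/n]*n x 4) (cong₂ _+_ x%4≡1 (quadruple (x / 4)))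
  where
  quadruple : ∀ a → a * 4 ≡ 2 * (2 * a)
  quadruple = solve-∀

-- With g = gcd m n, the coprime cofactor m / g divides (n / g)², hence n / g, hence equals 1.
m*m∣n*n⇒m∣n : ∀ {m n} .{{_ : NonZero m}} → m * m ∣ n * n → m ∣ n
m*m∣n*n⇒m∣n {m} {n} m²∣n² = subst (_∣ n) g≡m (gcd[m,n]∣n m n)
  where
  g = gcd m n
  instance
    g≢0 : NonZero g
    g≢0 = ≢-nonZero (gcd[m,n]≢0 m n (inj₁ (≢-nonZero⁻¹ m)))
    g²≢0 : NonZero (g * g)
    g²≢0 = m*n≢0 g g
  a = m / g
  b = n / g
  a*g≡m : a * g ≡ m
  a*g≡m = m/n*n≡m (gcd[m,n]∣m m n)
  b*g≡n : b * g ≡ n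
  b*g≡n = m/n*n≡m (gcd[m,n]∣n m n)
  a²g²∣b²g² : a * a * (g * g) ∣ b * b * (g * g)
  a²g²∣b²g² = subst₂ _∣_
    (trans (cong₂ _*_ (sym a*g≡m) (sym a*g≡m)) ([m*n]*[o*p]≡[m*o]*[n*p] a g a g))
    (trans (cong₂ _*_ (sym b*g≡n) (sym b*g≡n)) ([m*n]*[o*p]≡[m*o]*[n*p] b g b g)) m²∣n²
  a∣b : a ∣ b
  a∣b = coprime-divisor (coprime-/gcd m n) (∣-trans (m∣m*n a) (*-cancelʳ-∣ (g * g) a²g²∣b²g²))
  g≡m : g ≡ m
  g≡m = trans (sym (*-identityˡ g)) (trans (cong (_* g) (sym (coprime-/gcd m n (∣-refl , a∣b)))) a*g≡m)

m*n≡o*o⇒[m∣o⇔o∣n] : ∀ {m n o} .{{_ : NonZero m}} .{{_ : NonZero o}} → m * n ≡ o * o → m ∣ o ⇔ o ∣ n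
m*n≡o*o⇒[m∣o⇔o∣n] {m} {n} {o} mn≡o² = mk⇔ m∣o⇒o∣n o∣n⇒m∣o
  where
  m∣o⇒o∣n : m ∣ o → o ∣ n
  m∣o⇒o∣n (divides u o≡u*m) = divides u (*-cancelˡ-≡ n (u * o) m (begin
    m * n          ≡⟨ mn≡o² ⟩
    o * o          ≡⟨ cong (_* o) o≡u*m ⟩
    u * m * o      ≡⟨ cong (_* o) (*-comm u m) ⟩
    m * u * o      ≡⟨ *-assoc m u o ⟩
    m * (u * o)    ∎))
    where open ≡-Reasoning
  o∣n⇒m∣o : o ∣ n → m ∣ o
  o∣n⇒m∣o (divides v n≡v*o) = divides v (*-cancelʳ-≡ o (v * m) o (begin
    o * o          ≡⟨ mn≡o² ⟨
    m * n          ≡⟨ cong (m *_) n≡v*o ⟩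
    m * (v * o)    ≡⟨ *-assoc m v o ⟨
    m * v * o      ≡⟨ cong (_* o) (*-comm m v) ⟩
    v * m * o      ∎))
    where open ≡-Reasoning

m*n≡o*o⇒[m∣n⇔m∣o] : ∀ {m n o} .{{_ : NonZero m}} .{{_ : NonZero o}} → m * n ≡ o * o → m ∣ n ⇔ m ∣ o
m*n≡o*o⇒[m∣n⇔m∣o] {m} {n} {o} mn≡o² = mk⇔
  (λ m∣n → m*m∣n*n⇒m∣n (subst (m * m ∣_) mn≡o² (*-monoʳ-∣ m m∣n)))
  (λ m∣o → ∣-trans m∣o (Equivalence.to (m*n≡o*o⇒[m∣o⇔o∣n] mn≡o²) m∣o))

coprime⇒[∣⇔∣*] : ∀ {d a m} → Coprime d a → d ∣ m ⇔ d ∣ a * m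
coprime⇒[∣⇔∣*] {a = a} d⊥a = mk⇔ (∣n⇒∣m*n a) (coprime-divisor d⊥a)

gcd[m,n]≡m⇔m∣n : ∀ {m n} → gcd m n ≡ m ⇔ m ∣ n
gcd[m,n]≡m⇔m∣n {m} {n} = mk⇔
  (λ g≡m → subst (_∣ n) g≡m (gcd[m,n]∣n m n))
  (λ m∣n → ∣-antisym (gcd[m,n]∣m m n) (gcd-greatest ∣-refl m∣n))

gcd[2h,t]≡h⇔h∣t : ∀ {h t} → ¬ 2 ∣ t → gcd (2 * h) t ≡ h ⇔ h ∣ t
gcd[2h,t]≡h⇔h∣t {h} {t} 2∤t = mk⇔
  (λ g≡h → subst (_∣ t) g≡h (gcd[m,n]∣n (2 * h) t))
  (λ h∣t → ∣-antisym (coprime-divisor g⊥2 (gcd[m,n]∣m (2 * h) t)) (gcd-greatest (n∣m*n 2) h∣t))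
  where
  g⊥2 : Coprime (gcd (2 * h) t) 2
  g⊥2 = Coprime.sym (¬∣⇒coprime prime[2] (λ 2∣g → 2∤t (∣-trans 2∣g (gcd[m,n]∣n (2 * h) t))))

module EulerianOPNFacts {N q k n : ℕ}
  (σ[N]≡2N : σ N ≡ 2 * N) (N%2≡1 : N % 2 ≡ 1) (N≡q^k*n² : N ≡ q ^ k * (n * n))
  (q-prime : Prime q) (0<n : 0 < n) (q%4≡1 : q % 4 ≡ 1) (k%4≡1 : k % 4 ≡ 1) (gcd[q,n]≡1 : gcd q n ≡ 1)
  where

  S = σ (q ^ k)
  T = σ (n * n)
  h = S / 2
  m = T / q ^ k

  instance
    n≢0 : NonZero n
    n≢0 = >-nonZero 0<n
    n²≢0 : NonZero (n * n)
    n²≢0 = m*n≢0 n n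
    q^k≢0 : NonZero (q ^ k)
    q^k≢0 = m^n≢0 q k {{prime⇒nonZero q-prime}}

  q≢1 : q ≢ 1
  q≢1 = nonTrivial⇒≢1 {{prime⇒nonTrivial q-prime}}

  n⊥q : Coprime n q
  n⊥q = Coprime.sym (gcd≡1⇒coprime gcd[q,n]≡1)

  σ[N]≡S*T : σ N ≡ S * T
  σ[N]≡S*T = begin
    σ N                          ≡⟨ cong σ N≡q^k*n² ⟩
    σ (q ^ k * (n * n))          ≡⟨ σ[p^k*m] q-prime q∤n² k ⟩
    geomSum q k * T              ≡⟨ cong (_* T) (σ[p^k] q-prime k) ⟨
    S * T                        ∎
    where
    open ≡-Reasoning
    q∤n : ¬ q ∣ n
    q∤n q∣n = q≢1 (Coprime.sym n⊥q (∣-refl , q∣n))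
    q∤n² : ¬ q ∣ n * n
    q∤n² q∣n² = q∤n (reduce (euclidsLemma n n q-prime q∣n²))

  -- Only the parities of q and k matter here.
  S≡2h : S ≡ 2 * h
  S≡2h = sym (m*[n/m]≡n 2∣S)
    where
    double-suc : ∀ a → 1 + (1 + 2 * a) ≡ (1 + a) * 2
    double-suc = solve-∀
    2∣S : 2 ∣ S
    2∣S with %4≡1⇒odd q q%4≡1 | %4≡1⇒odd k k%4≡1
    ... | a , q≡1+2a | t , k≡1+2t =
      subst (2 ∣_) (sym (trans (σ[p^k] q-prime k) (cong (geomSum q) k≡1+2t)))
        (∣-trans (divides (1 + a) (trans (cong (1 +_) q≡1+2a) (double-suc a))) (1+p∣geomSum[1+2t] q t))

  h*T≡N : h * T ≡ N
  h*T≡N = *-cancelˡ-≡ (h * T) N 2 (begin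
    2 * (h * T)    ≡⟨ *-assoc 2 h T ⟨
    2 * h * T      ≡⟨ cong (_* T) S≡2h ⟨
    S * T          ≡⟨ σ[N]≡S*T ⟨
    σ N            ≡⟨ σ[N]≡2N ⟩
    2 * N          ∎)
    where open ≡-Reasoning

  T-odd : ¬ 2 ∣ T
  T-odd 2∣T = 0≢1+n (trans (sym (n∣m⇒m%n≡0 N 2 (subst (2 ∣_) h*T≡N (∣n⇒∣m*n h 2∣T)))) N%2≡1)

  h⊥q : Coprime h q
  h⊥q = Coprime.sym (¬∣⇒coprime q-prime q∤h)
    where
    q∤h : ¬ q ∣ h
    q∤h q∣h = p∤geomSum q≢1 k
      (subst (q ∣_) (trans (sym S≡2h) (σ[p^k] q-prime k)) (∣n⇒∣m*n 2 q∣h))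

  T≡q^k*m : T ≡ q ^ k * m
  T≡q^k*m = sym (m*[n/m]≡n (coprime-divisor (Coprime.sym (coprime-^ k h⊥q)) (divides (n * n) q^k*n²≡h*T)))
    where
    q^k*n²≡h*T : h * T ≡ n * n * q ^ k
    q^k*n²≡h*T = trans h*T≡N (trans N≡q^k*n² (*-comm (q ^ k) (n * n)))

  h*m≡n*n : h * m ≡ n * n
  h*m≡n*n = *-cancelˡ-≡ (h * m) (n * n) (q ^ k) (begin
    q ^ k * (h * m)    ≡⟨ *-assoc (q ^ k) h m ⟨
    q ^ k * h * m      ≡⟨ cong (_* m) (*-comm (q ^ k) h) ⟩
    h * q ^ k * m      ≡⟨ *-assoc h (q ^ k) m ⟩
    h * (q ^ k * m)    ≡⟨ cong (h *_) T≡q^k*m ⟨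
    h * T              ≡⟨ h*T≡N ⟩
    N                  ≡⟨ N≡q^k*n² ⟩
    q ^ k * (n * n)    ∎)
    where open ≡-Reasoning

  instance
    h≢0 : NonZero h
    h≢0 = m*n≢0⇒m≢0 h {m} {{subst NonZero (sym h*m≡n*n) n²≢0}}

  h∣n⇔n∣T : h ∣ n ⇔ n ∣ T
  h∣n⇔n∣T = begin
    h ∣ n            ≈⟨ m*n≡o*o⇒[m∣o⇔o∣n] h*m≡n*n ⟩
    n ∣ m            ≈⟨ coprime⇒[∣⇔∣*] (coprime-^ k n⊥q) ⟩
    n ∣ q ^ k * m    ≡⟨ cong (n ∣_) T≡q^k*m ⟨
    n ∣ T            ∎
    where open ⇔-Reasoning

  h∣T⇔n∣T : h ∣ T ⇔ n ∣ T
  h∣T⇔n∣T = begin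
    h ∣ T            ≡⟨ cong (h ∣_) T≡q^k*m ⟩
    h ∣ q ^ k * m    ≈⟨ coprime⇒[∣⇔∣*] (coprime-^ k h⊥q) ⟨
    h ∣ m            ≈⟨ m*n≡o*o⇒[m∣n⇔m∣o] h*m≡n*n ⟩
    h ∣ n            ≈⟨ h∣n⇔n∣T ⟩
    n ∣ T            ∎
    where open ⇔-Reasoning

  n∣T⇔gcd[S,T]≡h : n ∣ T ⇔ gcd S T ≡ h
  n∣T⇔gcd[S,T]≡h = begin
    n ∣ T                ≈⟨ h∣T⇔n∣T ⟨
    h ∣ T                ≈⟨ gcd[2h,t]≡h⇔h∣t T-odd ⟨
    gcd (2 * h) T ≡ h    ≡⟨ cong (λ s → gcd s T ≡ h) S≡2h ⟨
    gcd S T ≡ h          ∎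
    where open ⇔-Reasoning

  gcd[S,T]≡h⇔gcd[n,T]≡n : gcd S T ≡ h ⇔ gcd n T ≡ n
  gcd[S,T]≡h⇔gcd[n,T]≡n = begin
    gcd S T ≡ h          ≈⟨ n∣T⇔gcd[S,T]≡h ⟨
    n ∣ T                ≈⟨ gcd[m,n]≡m⇔m∣n ⟨
    gcd n T ≡ n          ∎
    where open ⇔-Reasoning

theorem2 : (N q k n : ℕ) → EulerianOPN N q k n →
    let G = gcd (σ (q ^ k)) (σ (n * n))
        I = gcd n (σ (n * n))
        h = σ (q ^ k) / 2
    in ((h ∣ n) ⇔ (n ∣ σ (n * n))) × ((n ∣ σ (n * n)) ⇔ (G ≡ h)) × ((G ≡ h) ⇔ (I ≡ n))
theorem2 N q k n ((_ , σ[N]≡2N) , N%2≡1 , N≡q^k*n² , q-prime , _ , 0<n , q%4≡1 , k%4≡1 , gcd[q,n]≡1) =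
  h∣n⇔n∣T , n∣T⇔gcd[S,T]≡h , gcd[S,T]≡h⇔gcd[n,T]≡n
  where
  open EulerianOPNFacts {N} {q} {k} {n} σ[N]≡2N N%2≡1 N≡q^k*n² q-prime 0<n q%4≡1 k%4≡1 gcd[q,n]≡1
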